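{- Let $T$ be a tree with $n\geq 3$ vertices in which no two vertices of degree $2$ are adjacent and no leaf is adjacent to a vertex of degree $2$. Then $T$ has at least $\frac{n+5}{3}$ leaves. -}

module Defs where

open import Data.Nat using (ℕ; zero; suc; _+_; _*_; _≤_)
open import Data.Fin using (Fin)
open import Data.Bool using (Bool; true; false; T)
open import Data.List using (List; []; _∷_; length; filter)
open import Data.List.Relation.Unary.AllPairs using (AllPairs)
open import Data.List.Relation.Unary.Unique.Propositional using (Unique)
open import Data.List.Base using (allFin)
open import Data.Product using (Σ; _×_; ∃)
open import Relation.Nullary using (¬_)
open import Relation.Binary.PropositionalEquality using (_≡_; _≢_)
open import Data.Nat.Properties using (_≟_)
open import Relation.Nullary.Decidable using (does)

record Graph (n : ℕ) : Set where
  field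
    adj   : Fin n → Fin n → Bool
    sym   : ∀ u v → adj u v ≡ adj v u
    irrefl : ∀ v → adj v v ≡ false

open Graph public

Adj : ∀ {n} → Graph n → Fin n → Fin n → Set
Adj G u v = T (adj G u v)

degree : ∀ {n} → Graph n → Fin n → ℕ
degree G v = length (filter (λ u → T? (adj G v u)) (allFin _))
  where
  open import Data.Bool.Properties using (T?)

data Walk {n} (G : Graph n) : Fin n → Fin n → Set where
  here : ∀ v → Walk G v v
  step : ∀ {u w v} → Adj G u w → Walk G w v → Walk G u v

verts : ∀ {n} {G : Graph n} {u v} → Walk G u v → List (Fin n)
verts (here v) = v ∷ []
verts (step {u = u} _ w) = u ∷ verts w

len : ∀ {n} {G : Graph n} {u v} → Walk G u v → ℕ
len (here _) = 0
len (step _ w) = suc (len w)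

Connected : ∀ {n} → Graph n → Set
Connected G = ∀ u v → Walk G u v

-- A cycle: a walk u ~> w through pairwise distinct vertices, of
-- length ≥ 2 (so ≥ 3 vertices), closed up by an edge w — u.
HasCycle : ∀ {n} → Graph n → Set
HasCycle {n} G =
  Σ (Fin n) λ u → Σ (Fin n) λ w → Σ (Walk G u w) λ p →
    Unique (verts p) × (2 ≤ len p) × Adj G w u

IsTree : ∀ {n} → Graph n → Set
IsTree G = Connected G × ¬ HasCycle G

leaves : ∀ {n} → Graph n → ℕ
leaves G = length (filter (λ v → degree G v ≟ 1) (allFin _))

-- Let L, B and A count the vertices of degree 1, 2 and at least 3, and let Q be the
-- total degree of the last class. A tree has degree sum 2n − 2, so
-- L + 2B + Q + 2 ≤ 2(L + B + A). By the hypotheses, and because two leaves cannot be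
-- adjacent once n ≥ 3, no two vertices of degree at most 2 are adjacent; hence every
-- edge at such a vertex ends at a vertex of degree at least 3, and L + 2B ≤ Q.
-- Together with 3A ≤ Q this gives A + 2 ≤ L and B + 1 ≤ A, so n = L + B + A ≤ 3L − 5.
-- The degree-sum bound comes from orienting each edge towards a root along shortest
-- walks: adjacent vertices are at different distances from the root, and no vertex has
-- two neighbours closer to it, since either situation would close a cycle.
module Submission where

open import Defs hiding (sym)
open import Data.Nat using (ℕ; zero; suc; _+_; _*_; _≤_; _<_; z≤n; s≤s; _<ᵇ_; _≡ᵇ_)
open import Data.Nat.Properties
open import Data.Nat.Induction using (<-rec)
open import Data.Nat.Tactic.RingSolver using (solve-∀)
open import Data.Fin using (Fin; zero; suc; punchIn; punchOut)
open import Data.Fin.Properties using (any?; punchInᵢ≢i; punchIn-injective; punchIn-punchOut)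
  renaming (_≟_ to _≟ᶠ_; suc-injective to suc-injectiveᶠ)
open import Data.Bool using (Bool; true; false; T; _∧_; not; if_then_else_)
open import Data.Bool.Properties using (T?; T-∧; ∧-identityʳ; ∧-zeroʳ)
open import Data.List using (List; []; _∷_; length; filter; tabulate)
open import Data.List.Membership.Propositional using (_∈_)
import Data.List.Membership.DecPropositional as DecMembership
open import Data.List.Relation.Unary.All as All using (All; []; _∷_)
open import Data.List.Relation.Unary.All.Properties using (¬Any⇒All¬)
open import Data.List.Relation.Unary.Any using (here; there)
open import Data.List.Relation.Unary.AllPairs using ([]; _∷_)
open import Data.List.Relation.Unary.Unique.Propositional using (Unique)
open import Data.Product using (Σ; ∃-syntax; _×_; _,_; proj₁; proj₂)
open import Data.Sum using (_⊎_; inj₁; inj₂)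
open import Data.Empty using (⊥; ⊥-elim)
open import Function using (_∘_; id; Equivalence)
open import Level using (0ℓ; _⊔_)
open import Relation.Binary using (Rel; DecidableEquality)
open import Relation.Binary.Construct.Closure.ReflexiveTransitive as Star using (Star; ε; _◅_; _◅◅_)
open import Relation.Binary.PropositionalEquality
open import Relation.Nullary using (¬_; Dec; yes; no; does)
open import Relation.Nullary.Decidable using (_×-dec_)
open import Relation.Nullary.Reflects using (ofʸ; ofⁿ)
open import Relation.Unary using (Pred; Decidable)
open import Algebra.Properties.Semiring.Sum +-*-semiring
  using (sum; sum-syntax; sum-cong-≗; ∑-distrib-+; ∑-comm; *-distribˡ-sum; sum-replicate-zero)

𝟙 : Bool → ℕ
𝟙 true  = 1
𝟙 false = 0

count : ∀ {n} → (Fin n → Bool) → ℕ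
count {n} p = ∑[ i < n ] 𝟙 (p i)

sum-mono-≤ : ∀ {n} {f g : Fin n → ℕ} → (∀ i → f i ≤ g i) → sum f ≤ sum g
sum-mono-≤ {zero}  f≤g = z≤n
sum-mono-≤ {suc n} f≤g = +-mono-≤ (f≤g zero) (sum-mono-≤ (f≤g ∘ suc))

sum-const-1 : ∀ n → ∑[ i < n ] 1 ≡ n
sum-const-1 zero    = refl
sum-const-1 (suc n) = cong suc (sum-const-1 n)

length-filter-tabulate : ∀ {a p} {A : Set a} {P : Pred A p} (P? : Decidable P) {n} (f : Fin n → A) →
                         length (filter P? (tabulate f)) ≡ ∑[ i < n ] 𝟙 (does (P? (f i)))
length-filter-tabulate P? {zero}  f = refl
length-filter-tabulate P? {suc n} f with does (P? (f zero))
... | true  = cong suc (length-filter-tabulate P? (f ∘ suc))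
... | false = length-filter-tabulate P? (f ∘ suc)

count-∧-≤ : ∀ {n} (p q : Fin n → Bool) → count (λ i → p i ∧ q i) ≤ count p
count-∧-≤ p q = sum-mono-≤ λ i → 𝟙-∧ (p i) (q i)
  where
  𝟙-∧ : ∀ a b → 𝟙 (a ∧ b) ≤ 𝟙 a
  𝟙-∧ true  true  = ≤-refl
  𝟙-∧ true  false = z≤n
  𝟙-∧ false b     = z≤n

count-≡0 : ∀ {n} (p : Fin n → Bool) → (∀ i → ¬ T (p i)) → count p ≡ 0
count-≡0 {zero}  p none = refl
count-≡0 {suc n} p none with p zero | none zero
... | false | _     = count-≡0 (p ∘ suc) (none ∘ suc)
... | true  | ¬p₀   = ⊥-elim (¬p₀ _)

count-≤1 : ∀ {n} (p : Fin n → Bool) → (∀ i j → T (p i) → T (p j) → i ≡ j) → count p ≤ 1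
count-≤1 {zero}  p unique = z≤n
count-≤1 {suc n} p unique with p zero in p₀
... | false = count-≤1 (p ∘ suc) λ i j pi pj → suc-injectiveᶠ (unique (suc i) (suc j) pi pj)
... | true  = ≤-reflexive (cong suc (count-≡0 (p ∘ suc) λ i pi → 0≢suc (unique zero (suc i) (subst T (sym p₀) _) pi)))
  where
  0≢suc : ∀ {i : Fin n} → zero ≢ suc i
  0≢suc ()

count-≥1 : ∀ {n} (p : Fin n → Bool) {i} → T (p i) → 1 ≤ count p
count-≥1 p {zero}  pi with p zero
... | true = s≤s z≤n
count-≥1 p {suc i} pi = ≤-trans (count-≥1 (p ∘ suc) pi) (m≤n+m _ (𝟙 (p zero)))

count-≥2 : ∀ {n} (p : Fin n → Bool) {i j} → i ≢ j → T (p i) → T (p j) → 2 ≤ count p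
count-≥2 p {zero}  {zero}  i≢j pi pj = ⊥-elim (i≢j refl)
count-≥2 p {zero}  {suc j} i≢j pi pj with p zero
... | true = s≤s (count-≥1 (p ∘ suc) pj)
count-≥2 p {suc i} {zero}  i≢j pi pj with p zero
... | true = s≤s (count-≥1 (p ∘ suc) pi)
count-≥2 p {suc i} {suc j} i≢j pi pj =
  ≤-trans (count-≥2 (p ∘ suc) (i≢j ∘ cong suc) pi pj) (m≤n+m _ (𝟙 (p zero)))

minimal-witness : ∀ {p} {P : Pred ℕ p} → Decidable P → ∀ {m} → P m →
                  ∃[ k ] P k × (∀ {j} → j < k → ¬ P j)
minimal-witness {p} {P} P? {m} = <-rec (λ m → P m → Minimal) search m
  where
  Minimal : Set p
  Minimal = ∃[ k ] P k × (∀ {j} → j < k → ¬ P j)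
  search : ∀ m → (∀ {j} → j < m → P j → Minimal) → P m → Minimal
  search m below pm with anyUpTo? P? m
  ... | yes (j , j<m , pj) = below j<m pj
  ... | no  none           = m , pm , λ j<m pj → none (_ , j<m , pj)

module _ {a ℓ} {A : Set a} {R : Rel A ℓ} where

  vertices : ∀ {x y} → Star R x y → List A
  vertices {x} ε       = x ∷ []
  vertices {x} (_ ◅ p) = x ∷ vertices p

  Path : A → A → Set (a ⊔ ℓ)
  Path x y = Σ (Star R x y) (Unique ∘ vertices)

  suffix-path : ∀ {x y z} (p : Star R x y) → Unique (vertices p) → z ∈ vertices p → Path z y
  suffix-path ε       p!       (here refl)  = ε , p!
  suffix-path (r ◅ p) p!       (here refl)  = r ◅ p , p!
  suffix-path (r ◅ p) (_ ∷ p!) (there z∈p)  = suffix-path p p! z∈p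

  module _ (_≟_ : DecidableEquality A) where
    open DecMembership _≟_ using (_∈?_)

    loop-erase : ∀ {x y} → Star R x y → Path x y
    loop-erase ε = ε , [] ∷ []
    loop-erase {x} (r ◅ p) with loop-erase p
    ... | q , q! with x ∈? vertices q
    ...   | yes x∈q = suffix-path q q! x∈q
    ...   | no  x∉q = r ◅ q , ¬Any⇒All¬ _ x∉q ∷ q!

module _ {n} (G : Graph n) where

  adj-sym : ∀ {u v} → Adj G u v → Adj G v u
  adj-sym {u} {v} = subst T (Graph.sym G u v)

  adj⇒≢ : ∀ {u v} → Adj G u v → u ≢ v
  adj⇒≢ {u} uv refl = subst T (irrefl G u) uv

  module _ {ℓ} {R : Rel (Fin n) ℓ} (R⇒Adj : ∀ {x y} → R x y → Adj G x y) where

    toWalk : ∀ {x y} → Star R x y → Walk G x y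
    toWalk ε       = here _
    toWalk (r ◅ p) = step (R⇒Adj r) (toWalk p)

    verts-toWalk : ∀ {x y} (p : Star R x y) → verts (toWalk p) ≡ vertices p
    verts-toWalk ε       = refl
    verts-toWalk (r ◅ p) = cong (_ ∷_) (verts-toWalk p)

  AdjWithout : Fin n → Fin n → Rel (Fin n) 0ℓ
  AdjWithout u v x y = Adj G x y × ¬ (x ≡ u × y ≡ v) × ¬ (x ≡ v × y ≡ u)

  AdjWithout-sym : ∀ {u v x y} → AdjWithout u v x y → AdjWithout u v y x
  AdjWithout-sym (xy , ≢uv , ≢vu) = adj-sym xy , (λ (p , q) → ≢vu (q , p)) , (λ (p , q) → ≢uv (q , p))

  bypass-len≥2 : ∀ {u v} → u ≢ v → (p : Star (AdjWithout u v) u v) → 2 ≤ len (toWalk proj₁ p)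
  bypass-len≥2 u≢v ε                       = ⊥-elim (u≢v refl)
  bypass-len≥2 u≢v ((_ , ≢uv , _) ◅ ε)     = ⊥-elim (≢uv (refl , refl))
  bypass-len≥2 u≢v (_ ◅ _ ◅ _)             = s≤s (s≤s z≤n)

  -- A bypass of the edge uv, shortened to a path, closes up with uv to a cycle.
  acyclic⇒no-bypass : ¬ HasCycle G → ∀ {u v} → Adj G u v → ¬ Star (AdjWithout u v) u v
  acyclic⇒no-bypass acyclic {u} {v} uv bypass with loop-erase _≟ᶠ_ bypass
  ... | p , p! = acyclic (u , v , toWalk proj₁ p , subst Unique (sym (verts-toWalk proj₁ p)) p! ,
                          bypass-len≥2 (adj⇒≢ uv) p , adj-sym uv)

  AdjAvoiding : Fin n → Rel (Fin n) 0ℓ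
  AdjAvoiding c x y = Adj G x y × x ≢ c × y ≢ c

  avoiding⇒withoutˡ : ∀ {u v x y} → AdjAvoiding u x y → AdjWithout u v x y
  avoiding⇒withoutˡ (xy , x≢u , y≢u) = xy , (λ (x≡u , _) → x≢u x≡u) , (λ (_ , y≡u) → y≢u y≡u)

  avoiding⇒withoutʳ : ∀ {u v x y} → AdjAvoiding v x y → AdjWithout u v x y
  avoiding⇒withoutʳ (xy , x≢v , y≢v) = xy , (λ (_ , y≡v) → y≢v y≡v) , (λ (x≡v , _) → x≢v x≡v)

  walk-avoiding : ∀ {c x y} (p : Walk G x y) → All (_≢ c) (verts p) → Star (AdjAvoiding c) x y
  walk-avoiding (here _)               _                        = ε
  walk-avoiding (step xz (here _))     (x≢c ∷ z≢c ∷ _)          = (xz , x≢c , z≢c) ◅ ε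
  walk-avoiding (step xz p@(step _ _)) (x≢c ∷ rest@(z≢c ∷ _)) = (xz , x≢c , z≢c) ◅ walk-avoiding p rest

module Distance {n} (G : Graph n) (connected : Connected G) (r : Fin n) where

  WalkOfLength : ℕ → Fin n → Set
  WalkOfLength k v = ∃[ p ] len {G = G} {v} {r} p ≡ k

  walkOfLength? : ∀ k v → Dec (WalkOfLength k v)
  walkOfLength? zero v with v ≟ᶠ r
  ... | yes refl = yes (here r , refl)
  ... | no  v≢r  = no λ { (here _ , _) → v≢r refl ; (step _ _ , ()) }
  walkOfLength? (suc k) v with any? (λ u → T? (adj G v u) ×-dec walkOfLength? k u)
  ... | yes (u , vu , p , refl) = yes (step vu p , refl)
  ... | no  none                = no λ { (step vu p , refl) → none (_ , vu , p , refl) }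

  -- Opaque so that dist stays neutral and `with dist u <ᵇ dist v` can abstract over it.
  opaque
    shortest : ∀ v → ∃[ k ] WalkOfLength k v × (∀ {j} → j < k → ¬ WalkOfLength j v)
    shortest v = minimal-witness (λ k → walkOfLength? k v) (connected v r , refl)

  dist : Fin n → ℕ
  dist v = proj₁ (shortest v)

  geodesic : ∀ v → Walk G v r
  geodesic v = proj₁ (proj₁ (proj₂ (shortest v)))

  len-geodesic : ∀ v → len (geodesic v) ≡ dist v
  len-geodesic v = proj₂ (proj₁ (proj₂ (shortest v)))

  dist-≤-len : ∀ {v} (p : Walk G v r) → dist v ≤ len p
  dist-≤-len {v} p = ≮⇒≥ λ shorter → proj₂ (proj₂ (shortest v)) shorter (p , refl)

  dist-root : dist r ≡ 0
  dist-root = n≤0⇒n≡0 (dist-≤-len (here r))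

  walk-suffix : ∀ {x y} (p : Walk G x r) → y ∈ verts p → y ≡ x ⊎ ∃[ q ] len {G = G} {y} {r} q < len p
  walk-suffix (here _)   (here refl)  = inj₁ refl
  walk-suffix (step _ p) (here refl)  = inj₁ refl
  walk-suffix (step _ p) (there y∈p) with walk-suffix p y∈p
  ... | inj₁ refl        = inj₂ (p , ≤-refl)
  ... | inj₂ (q , q<p)   = inj₂ (q , m≤n⇒m≤1+n q<p)

  geodesic-descends : ∀ {x y} → y ∈ verts (geodesic x) → y ≡ x ⊎ dist y < dist x
  geodesic-descends {x} y∈p with walk-suffix (geodesic x) y∈p
  ... | inj₁ y≡x       = inj₁ y≡x
  ... | inj₂ (q , q<p) = inj₂ (≤-<-trans (dist-≤-len q) (subst (len q <_) (len-geodesic x) q<p))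

  geodesic-avoids : ∀ {x c} → x ≢ c → dist x ≤ dist c → All (_≢ c) (verts (geodesic x))
  geodesic-avoids {x} {c} x≢c dx≤dc = All.tabulate (avoids ∘ geodesic-descends)
    where
    avoids : ∀ {y} → y ≡ x ⊎ dist y < dist x → y ≢ c
    avoids (inj₁ refl) = x≢c
    avoids (inj₂ dy<dx) refl = <-irrefl refl (<-≤-trans dy<dx dx≤dc)

  module _ (acyclic : ¬ HasCycle G) where

    adj⇒dist-≢ : ∀ {u v} → Adj G u v → dist u ≢ dist v
    adj⇒dist-≢ {u} {v} uv du≡dv =
      acyclic⇒no-bypass G acyclic uv (u⇝r ◅◅ Star.reverse (AdjWithout-sym G) v⇝r)
      where
      u⇝r : Star (AdjWithout G u v) u r
      u⇝r = Star.map (avoiding⇒withoutʳ G)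
        (walk-avoiding G (geodesic u) (geodesic-avoids (adj⇒≢ G uv) (≤-reflexive du≡dv)))
      v⇝r : Star (AdjWithout G u v) v r
      v⇝r = Star.map (avoiding⇒withoutˡ G)
        (walk-avoiding G (geodesic v) (geodesic-avoids (adj⇒≢ G (adj-sym G uv)) (≤-reflexive (sym du≡dv))))

    closer-neighbour-unique : ∀ {v x y} → Adj G v x → Adj G v y → dist x < dist v → dist y < dist v → x ≡ y
    closer-neighbour-unique {v} {x} {y} vx vy dx<dv dy<dv with x ≟ᶠ y
    ... | yes x≡y = x≡y
    ... | no  x≢y = ⊥-elim (acyclic⇒no-bypass G acyclic vx bypass)
      where
      ⇝r : ∀ {z} → Adj G v z → dist z < dist v → Star (AdjWithout G v x) z r
      ⇝r vz dz<dv = Star.map (avoiding⇒withoutˡ G)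
        (walk-avoiding G (geodesic _) (geodesic-avoids (adj⇒≢ G (adj-sym G vz)) (<⇒≤ dz<dv)))
      first : AdjWithout G v x v y
      first = vy , (λ (_ , y≡x) → x≢y (sym y≡x)) , (λ (v≡x , _) → adj⇒≢ G vx v≡x)
      bypass : Star (AdjWithout G v x) v x
      bypass = first ◅ ⇝r vy dy<dv ◅◅ Star.reverse (AdjWithout-sym G) (⇝r vx dx<dv)

degree-count : ∀ {n} (G : Graph n) v → degree G v ≡ count (adj G v)
degree-count G v = length-filter-tabulate (λ u → T? (adj G v u)) id

module _ {m} (G : Graph (suc m)) (connected : Connected G) (acyclic : ¬ HasCycle G) where

  open Distance G connected zero

  closer : Fin (suc m) → Fin (suc m) → Bool
  closer v u = adj G v u ∧ (dist u <ᵇ dist v)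

  𝟙-adj-orient : ∀ v u → 𝟙 (adj G v u) ≡ 𝟙 (closer v u) + 𝟙 (closer u v)
  𝟙-adj-orient v u rewrite Graph.sym G u v
    with adj G v u in vu | dist u <ᵇ dist v | <ᵇ-reflects-< (dist u) (dist v)
                         | dist v <ᵇ dist u | <ᵇ-reflects-< (dist v) (dist u)
  ... | false | _ | _         | _ | _         = refl
  ... | true  | _ | ofʸ _     | _ | ofⁿ _     = refl
  ... | true  | _ | ofⁿ _     | _ | ofʸ _     = refl
  ... | true  | _ | ofʸ du<dv | _ | ofʸ dv<du = ⊥-elim (<-asym du<dv dv<du)
  ... | true  | _ | ofⁿ du≮dv | _ | ofⁿ dv≮du =
    ⊥-elim (adj⇒dist-≢ acyclic (subst T (sym vu) _) (sym (≤-antisym (≮⇒≥ dv≮du) (≮⇒≥ du≮dv))))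

  closer⇒ : ∀ {v u} → T (closer v u) → Adj G v u × dist u < dist v
  closer⇒ {v} {u} vu with adj G v u | dist u <ᵇ dist v | <ᵇ-reflects-< (dist u) (dist v)
  ... | true | true | ofʸ du<dv = _ , du<dv

  parents : Fin (suc m) → ℕ
  parents v = count (closer v)

  parents-≤1 : ∀ v → parents v ≤ 1
  parents-≤1 v = count-≤1 (closer v) λ x y vx vy →
    closer-neighbour-unique acyclic (proj₁ (closer⇒ vx)) (proj₁ (closer⇒ vy)) (proj₂ (closer⇒ vx)) (proj₂ (closer⇒ vy))

  parents-root : parents zero ≡ 0
  parents-root = count-≡0 (closer zero) λ u root-u →
    n≮0 (subst (dist u <_) dist-root (proj₂ (closer⇒ root-u)))

  parent-total : ℕ
  parent-total = ∑[ v < suc m ] parents v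

  degree-sum-parents : ∑[ v < suc m ] degree G v ≡ 2 * parent-total
  degree-sum-parents = begin
    ∑[ v < suc m ] degree G v                                              ≡⟨ sum-cong-≗ (degree-count G) ⟩
    ∑[ v < suc m ] ∑[ u < suc m ] 𝟙 (adj G v u)                            ≡⟨ sum-cong-≗ (λ v → sum-cong-≗ (𝟙-adj-orient v)) ⟩
    ∑[ v < suc m ] ∑[ u < suc m ] (𝟙 (closer v u) + 𝟙 (closer u v))        ≡⟨ sum-cong-≗ (λ v → ∑-distrib-+ (𝟙 ∘ closer v) (λ u → 𝟙 (closer u v))) ⟩
    ∑[ v < suc m ] (parents v + ∑[ u < suc m ] 𝟙 (closer u v))             ≡⟨ ∑-distrib-+ parents (λ v → ∑[ u < suc m ] 𝟙 (closer u v)) ⟩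
    parent-total + ∑[ v < suc m ] ∑[ u < suc m ] 𝟙 (closer u v)           ≡⟨ cong (parent-total +_) (∑-comm (λ v u → 𝟙 (closer u v))) ⟩
    parent-total + parent-total                                            ≡⟨ cong (parent-total +_) (+-identityʳ parent-total) ⟨
    2 * parent-total                                                       ∎
    where open ≡-Reasoning

  parent-total≤m : parent-total ≤ m
  parent-total≤m = begin
    parents zero + ∑[ v < m ] parents (suc v) ≤⟨ +-mono-≤ (≤-reflexive parents-root) (sum-mono-≤ (parents-≤1 ∘ suc)) ⟩
    0 + ∑[ v < m ] 1                          ≡⟨ sum-const-1 m ⟩
    m                                         ∎
    where open ≤-Reasoning

  tree-degree-sum : ∑[ v < suc m ] degree G v + 2 ≤ 2 * suc m
  tree-degree-sum = begin
    ∑[ v < suc m ] degree G v + 2 ≡⟨ cong (_+ 2) degree-sum-parents ⟩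
    2 * parent-total + 2          ≡⟨ *-distribˡ-+ 2 parent-total 1 ⟨
    2 * (parent-total + 1)        ≤⟨ *-monoʳ-≤ 2 (+-monoˡ-≤ 1 parent-total≤m) ⟩
    2 * (m + 1)                   ≡⟨ cong (2 *_) (+-comm m 1) ⟩
    2 * suc m                     ∎
    where open ≤-Reasoning

leaf-count-arith : ∀ L B A Q → L + 2 * B + Q + 2 ≤ 2 * (L + B + A) → 3 * A ≤ Q → L + 2 * B ≤ Q →
                   L + B + A + 5 ≤ 3 * L
leaf-count-arith L B A Q handshake large small = begin
  L + B + A + 5               ≡⟨ regroup L B A ⟩
  L + (B + 1 + 2) + (A + 2)   ≤⟨ +-mono-≤ (+-monoʳ-≤ L (≤-trans (+-monoˡ-≤ 2 B+1≤A) A+2≤L)) A+2≤L ⟩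
  L + L + L                   ≡⟨ triple L ⟩
  3 * L                       ∎
  where
  open ≤-Reasoning
  regroup : ∀ L B A → L + B + A + 5 ≡ L + (B + 1 + 2) + (A + 2)
  regroup = solve-∀
  triple : ∀ L → L + L + L ≡ 3 * L
  triple = solve-∀
  Q+2≤L+2A : Q + 2 ≤ L + 2 * A
  Q+2≤L+2A = +-cancelˡ-≤ (L + 2 * B) _ _ (subst₂ _≤_ (lhs L B Q) (rhs L B A) handshake)
    where
    lhs : ∀ L B Q → L + 2 * B + Q + 2 ≡ L + 2 * B + (Q + 2)
    lhs = solve-∀
    rhs : ∀ L B A → 2 * (L + B + A) ≡ L + 2 * B + (L + 2 * A)
    rhs = solve-∀
  A+2≤L : A + 2 ≤ L
  A+2≤L = +-cancelˡ-≤ (2 * A) _ _ (subst₂ _≤_ (lhs A) (+-comm L (2 * A)) (≤-trans (+-monoˡ-≤ 2 large) Q+2≤L+2A))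
    where
    lhs : ∀ A → 3 * A + 2 ≡ 2 * A + (A + 2)
    lhs = solve-∀
  B+1≤A : B + 1 ≤ A
  B+1≤A = *-cancelˡ-≤ 2 (+-cancelˡ-≤ L _ _ (subst (_≤ L + 2 * A) (lhs L B) (≤-trans (+-monoˡ-≤ 2 small) Q+2≤L+2A)))
    where
    lhs : ∀ L B → L + 2 * B + 2 ≡ L + 2 * (B + 1)
    lhs = solve-∀

third-vertex : ∀ {k} (u v : Fin (3 + k)) → ∃[ w ] w ≢ u × w ≢ v
third-vertex u v with u ≟ᶠ v
... | yes refl = punchIn u zero , punchInᵢ≢i u zero , punchInᵢ≢i u zero
... | no  u≢v  = punchIn u (punchIn v′ zero) , punchInᵢ≢i u _ , λ w≡v →
  punchInᵢ≢i v′ zero (punchIn-injective u _ _ (trans w≡v (sym (punchIn-punchOut u≢v))))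
  where
  v′ : Fin (2 + _)
  v′ = punchOut u≢v

module _ {n} (G : Graph n) (connected : Connected G) where

  adj⇒degree≥1 : ∀ {v w} → Adj G v w → 1 ≤ degree G v
  adj⇒degree≥1 {v} vw = subst (1 ≤_) (sym (degree-count G v)) (count-≥1 (adj G v) vw)

  degree≥1 : ∀ {v w} → w ≢ v → 1 ≤ degree G v
  degree≥1 {v} {w} w≢v with connected v w
  ... | here _   = ⊥-elim (w≢v refl)
  ... | step vy _ = adj⇒degree≥1 vy

  degree≡1⇒unique-neighbour : ∀ {x y z} → degree G x ≡ 1 → Adj G x y → Adj G x z → y ≡ z
  degree≡1⇒unique-neighbour {x} {y} {z} dx≡1 xy xz with y ≟ᶠ z
  ... | yes y≡z = y≡z
  ... | no  y≢z = ⊥-elim (1+n≰n (subst (2 ≤_) (trans (sym (degree-count G x)) dx≡1) (count-≥2 (adj G x) y≢z xy xz)))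

  -- Leaves u, v joined by an edge form a whole component, which misses the third vertex w.
  leaves-nonadjacent : ∀ {u v w} → w ≢ u → w ≢ v → Adj G u v → degree G u ≡ 1 → degree G v ≡ 1 → ⊥
  leaves-nonadjacent {u} {v} {w} w≢u w≢v uv du≡1 dv≡1 = trapped (connected u w) (inj₁ refl)
    where
    trapped : ∀ {x} → Walk G x w → x ≡ u ⊎ x ≡ v → ⊥
    trapped (here _)   (inj₁ refl) = w≢u refl
    trapped (here _)   (inj₂ refl) = w≢v refl
    trapped (step xy p) (inj₁ refl) = trapped p (inj₂ (sym (degree≡1⇒unique-neighbour du≡1 uv xy)))
    trapped (step xy p) (inj₂ refl) = trapped p (inj₁ (sym (degree≡1⇒unique-neighbour dv≡1 (adj-sym G uv) xy)))

small : ℕ → Bool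
small m = m <ᵇ 3

small-degree large-degree : ℕ → ℕ
small-degree m = if small m then m else 0
large-degree m = if small m then 0 else m

𝟙≡1 𝟙≡2 𝟙≥3 : ℕ → ℕ
𝟙≡1 m = 𝟙 (m ≡ᵇ 1)
𝟙≡2 m = 𝟙 (m ≡ᵇ 2)
𝟙≥3 m = 𝟙 (not (small m))

degree-classes : ∀ {m} → 1 ≤ m → 𝟙≡1 m + 𝟙≡2 m + 𝟙≥3 m ≡ 1
degree-classes {suc zero}                _ = refl
degree-classes {suc (suc zero)}          _ = refl
degree-classes {suc (suc (suc _))}       _ = refl

small-degree-classes : ∀ m → small-degree m ≡ 𝟙≡1 m + 2 * 𝟙≡2 m
small-degree-classes zero                = refl
small-degree-classes (suc zero)          = refl
small-degree-classes (suc (suc zero))    = refl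
small-degree-classes (suc (suc (suc _))) = refl

small+large-degree : ∀ m → small-degree m + large-degree m ≡ m
small+large-degree m with small m
... | true  = +-identityʳ m
... | false = refl

3*𝟙≥3≤large-degree : ∀ m → 3 * 𝟙≥3 m ≤ large-degree m
3*𝟙≥3≤large-degree zero                = z≤n
3*𝟙≥3≤large-degree (suc zero)          = z≤n
3*𝟙≥3≤large-degree (suc (suc zero))    = z≤n
3*𝟙≥3≤large-degree (suc (suc (suc _))) = s≤s (s≤s (s≤s z≤n))

small⇒degree≡1⊎2 : ∀ {m} → 1 ≤ m → T (small m) → m ≡ 1 ⊎ m ≡ 2
small⇒degree≡1⊎2 {suc zero}       _ _ = inj₁ refl
small⇒degree≡1⊎2 {suc (suc zero)} _ _ = inj₂ refl

count-∧-const : ∀ {n} (p : Fin n → Bool) b → count (λ i → p i ∧ b) ≡ (if b then count p else 0)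
count-∧-const p true  = sum-cong-≗ λ i → cong 𝟙 (∧-identityʳ (p i))
count-∧-const {n} p false = trans (sum-cong-≗ λ i → cong 𝟙 (∧-zeroʳ (p i))) (sum-replicate-zero n)

module LeafBound {k} (G : Graph (3 + k)) (connected : Connected G)
  (no-2-2 : ∀ u v → Adj G u v → degree G u ≡ 2 → degree G v ≢ 2)
  (no-1-2 : ∀ u v → Adj G u v → degree G u ≡ 1 → degree G v ≢ 2) where

  δ : Fin (3 + k) → ℕ
  δ = degree G

  δ≥1 : ∀ v → 1 ≤ δ v
  δ≥1 v = degree≥1 G connected (punchInᵢ≢i v zero)

  small-independent : ∀ {u v} → Adj G u v → T (small (δ u)) → T (small (δ v)) → ⊥
  small-independent {u} {v} uv su sv with small⇒degree≡1⊎2 (δ≥1 u) su | small⇒degree≡1⊎2 (δ≥1 v) sv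
  ... | inj₁ du≡1 | inj₁ dv≡1 =
    let (w , w≢u , w≢v) = third-vertex u v in leaves-nonadjacent G connected w≢u w≢v uv du≡1 dv≡1
  ... | inj₁ du≡1 | inj₂ dv≡2 = no-1-2 u v uv du≡1 dv≡2
  ... | inj₂ du≡2 | inj₁ dv≡1 = no-1-2 v u (adj-sym G uv) dv≡1 du≡2
  ... | inj₂ du≡2 | inj₂ dv≡2 = no-2-2 u v uv du≡2 dv≡2

  small-neighbours : Fin (3 + k) → ℕ
  small-neighbours v = count (λ u → adj G v u ∧ small (δ u))

  small-neighbours≤large-degree : ∀ v → small-neighbours v ≤ large-degree (δ v)
  small-neighbours≤large-degree v with small (δ v) in sv
  ... | true  = ≤-reflexive (count-≡0 (λ u → adj G v u ∧ small (δ u)) λ u vu∧su →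
    let (vu , su) = Equivalence.to T-∧ vu∧su in small-independent vu (subst T (sym sv) _) su)
  ... | false = subst (small-neighbours v ≤_) (sym (degree-count G v)) (count-∧-≤ (adj G v) (small ∘ δ))

  small-degree-count : ∀ u → ∑[ v < 3 + k ] 𝟙 (adj G v u ∧ small (δ u)) ≡ small-degree (δ u)
  small-degree-count u = begin
    ∑[ v < 3 + k ] 𝟙 (adj G v u ∧ small (δ u)) ≡⟨ sum-cong-≗ (λ v → cong (λ b → 𝟙 (b ∧ small (δ u))) (Graph.sym G v u)) ⟩
    count (λ v → adj G u v ∧ small (δ u))       ≡⟨ count-∧-const (adj G u) (small (δ u)) ⟩
    (if small (δ u) then count (adj G u) else 0) ≡⟨ cong (λ c → if small (δ u) then c else 0) (degree-count G u) ⟨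
    small-degree (δ u)                          ∎
    where open ≡-Reasoning

  small-degree-sum≤large-degree-sum : ∑[ v < 3 + k ] small-degree (δ v) ≤ ∑[ v < 3 + k ] large-degree (δ v)
  small-degree-sum≤large-degree-sum = begin
    ∑[ u < 3 + k ] small-degree (δ u)                              ≡⟨ sum-cong-≗ small-degree-count ⟨
    ∑[ u < 3 + k ] ∑[ v < 3 + k ] 𝟙 (adj G v u ∧ small (δ u))     ≡⟨ ∑-comm (λ u v → 𝟙 (adj G v u ∧ small (δ u))) ⟩
    ∑[ v < 3 + k ] small-neighbours v                              ≤⟨ sum-mono-≤ small-neighbours≤large-degree ⟩
    ∑[ v < 3 + k ] large-degree (δ v)                              ∎
    where open ≤-Reasoning

  leaf-total two-total large-total large-degree-total : ℕ
  leaf-total         = ∑[ v < 3 + k ] 𝟙≡1 (δ v)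
  two-total          = ∑[ v < 3 + k ] 𝟙≡2 (δ v)
  large-total        = ∑[ v < 3 + k ] 𝟙≥3 (δ v)
  large-degree-total = ∑[ v < 3 + k ] large-degree (δ v)

  vertex-count : leaf-total + two-total + large-total ≡ 3 + k
  vertex-count = begin
    leaf-total + two-total + large-total           ≡⟨ cong (_+ large-total) (∑-distrib-+ (𝟙≡1 ∘ δ) (𝟙≡2 ∘ δ)) ⟨
    ∑[ v < 3 + k ] (𝟙≡1 (δ v) + 𝟙≡2 (δ v)) + large-total ≡⟨ ∑-distrib-+ (λ v → 𝟙≡1 (δ v) + 𝟙≡2 (δ v)) (𝟙≥3 ∘ δ) ⟨
    ∑[ v < 3 + k ] (𝟙≡1 (δ v) + 𝟙≡2 (δ v) + 𝟙≥3 (δ v)) ≡⟨ sum-cong-≗ (degree-classes ∘ δ≥1) ⟩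
    ∑[ v < 3 + k ] 1                                ≡⟨ sum-const-1 (3 + k) ⟩
    3 + k                                           ∎
    where open ≡-Reasoning

  small-degree-total : ∑[ v < 3 + k ] small-degree (δ v) ≡ leaf-total + 2 * two-total
  small-degree-total = begin
    ∑[ v < 3 + k ] small-degree (δ v)              ≡⟨ sum-cong-≗ (small-degree-classes ∘ δ) ⟩
    ∑[ v < 3 + k ] (𝟙≡1 (δ v) + 2 * 𝟙≡2 (δ v))     ≡⟨ ∑-distrib-+ (𝟙≡1 ∘ δ) (λ v → 2 * 𝟙≡2 (δ v)) ⟩
    leaf-total + ∑[ v < 3 + k ] (2 * 𝟙≡2 (δ v))    ≡⟨ cong (leaf-total +_) (*-distribˡ-sum 2 (𝟙≡2 ∘ δ)) ⟨
    leaf-total + 2 * two-total                      ∎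
    where open ≡-Reasoning

  degree-total : ∑[ v < 3 + k ] δ v ≡ leaf-total + 2 * two-total + large-degree-total
  degree-total = begin
    ∑[ v < 3 + k ] δ v                                                   ≡⟨ sum-cong-≗ (small+large-degree ∘ δ) ⟨
    ∑[ v < 3 + k ] (small-degree (δ v) + large-degree (δ v))             ≡⟨ ∑-distrib-+ (small-degree ∘ δ) (large-degree ∘ δ) ⟩
    ∑[ v < 3 + k ] small-degree (δ v) + large-degree-total               ≡⟨ cong (_+ large-degree-total) small-degree-total ⟩
    leaf-total + 2 * two-total + large-degree-total                      ∎
    where open ≡-Reasoning

  3*large-total≤large-degree-total : 3 * large-total ≤ large-degree-total
  3*large-total≤large-degree-total =
    subst (_≤ large-degree-total) (sym (*-distribˡ-sum 3 (𝟙≥3 ∘ δ))) (sum-mono-≤ (3*𝟙≥3≤large-degree ∘ δ))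

  small-total≤large-degree-total : leaf-total + 2 * two-total ≤ large-degree-total
  small-total≤large-degree-total = subst (_≤ large-degree-total) small-degree-total small-degree-sum≤large-degree-sum

  leaves≡leaf-total : leaves G ≡ leaf-total
  leaves≡leaf-total = length-filter-tabulate (λ v → degree G v ≟ 1) id

lemma5 : (n : ℕ) → 3 ≤ n → (T : Graph n) → IsTree T →
         (∀ u v → Adj T u v → degree T u ≡ 2 → degree T v ≢ 2) →
         (∀ u v → Adj T u v → degree T u ≡ 1 → degree T v ≢ 2) →
         n + 5 ≤ 3 * leaves T
lemma5 _ (s≤s (s≤s (s≤s _))) G (connected , acyclic) no-2-2 no-1-2 =
  subst₂ (λ n l → n + 5 ≤ 3 * l) vertex-count (sym leaves≡leaf-total)
    (leaf-count-arith leaf-total two-total large-total large-degree-total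
      handshake 3*large-total≤large-degree-total small-total≤large-degree-total)
  where
  open LeafBound G connected no-2-2 no-1-2
  handshake : leaf-total + 2 * two-total + large-degree-total + 2 ≤ 2 * (leaf-total + two-total + large-total)
  handshake = subst₂ (λ d n → d + 2 ≤ 2 * n) degree-total (sym vertex-count) (tree-degree-sum G connected acyclic)
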